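{- Suppose a symmetric $(v,k,\lambda)$-BIBD admits a $0$-ULSE $\ell$-colouring. Then $\lambda=\frac{k((\ell-1)^2-k)}{(\ell-1)^2}$, and for each colour, the number $\gamma$ of blocks that contain no point of that colour equals $\frac{v}{\ell}$.
   Context: For positive integers $v,k,\lambda$ with $2\le k<v$, a $(v,k,\lambda)$-BIBD is a pair $(V,\mathcal{B})$ where $V$ is a set of $v$ points and $\mathcal{B}$ is a collection of $k$-element subsets of $V$ (blocks) such that every pair of distinct points lies in exactly $\lambda$ blocks. It is symmetric if the number of blocks equals $v$ (equivalently, $\lambda(v-1)=k(k-1)$). An $\ell$-colouring is a surjective map from $V$ onto a set of $\ell$ colours. A $0$-ULSE $\ell$-colouring is an $\ell$-colouring such that $(\ell-1)$ divides $k$ and in every block exactly one colour does not appear, while each of the other $\ell-1$ colours appears exactly $\frac{k}{\ell-1}$ times in that block. -}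

module Defs where

open import Data.Nat using (ℕ; zero; suc; _+_; _*_; _∸_; _≤_; _<_)
open import Data.Nat.Divisibility using (_∣_)
open import Data.Fin using (Fin; zero; suc)
open import Data.Bool using (Bool; true; false; _∧_; not)
open import Data.Product using (Σ; ∃; _×_; _,_)
open import Relation.Binary.PropositionalEquality using (_≡_; _≢_)
open import Relation.Nullary using (Dec; does)
open import Data.Fin using (_≟_)

b2n : Bool → ℕ
b2n true  = 1
b2n false = 0

count : ∀ {n} → (Fin n → Bool) → ℕ
count {zero}  P = 0
count {suc n} P = b2n (P zero) + count (λ i → P (suc i))

-- Blocks are indexed, so repeated blocks are allowed ("collection").
record IsBIBD (v k lam b : ℕ) (inc : Fin b → Fin v → Bool) : Set where
  field
    two≤k     : 2 ≤ k
    k<v       : k < v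
    lam-pos   : 1 ≤ lam
    blockSize : ∀ j → count (inc j) ≡ k
    pairs     : ∀ (x y : Fin v) → x ≢ y →
                count (λ j → inc j x ∧ inc j y) ≡ lam

IsSymmetricBIBD : (v k lam : ℕ) → (Fin v → Fin v → Bool) → Set
IsSymmetricBIBD v k lam inc = IsBIBD v k lam v inc

hasColour : ∀ {v ℓ} → (Fin v → Fin ℓ) → Fin ℓ → Fin v → Bool
hasColour col c x = does (col x ≟ c)

colourCount : ∀ {v b ℓ} → (Fin b → Fin v → Bool) → (Fin v → Fin ℓ) →
              Fin b → Fin ℓ → ℕ
colourCount inc col j c = count (λ x → inc j x ∧ hasColour col c x)

Surjective : ∀ {v ℓ} → (Fin v → Fin ℓ) → Set
Surjective {v} {ℓ} col = ∀ (c : Fin ℓ) → ∃ λ (x : Fin v) → col x ≡ c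

-- 0-ULSE ℓ-colouring: (ℓ-1) ∣ k, and in every block exactly one colour
-- is absent while every other colour appears exactly k/(ℓ-1) times.
-- "k/(ℓ-1) times" is stated as  (ℓ-1) * count ≡ k  (exact since (ℓ-1) ∣ k
-- and ℓ-1 ≠ 0 because k ≥ 2).
record Is0ULSE (v k b ℓ : ℕ) (inc : Fin b → Fin v → Bool)
               (col : Fin v → Fin ℓ) : Set where
  field
    surjective : Surjective col
    divides    : (ℓ ∸ 1) ∣ k
    absent     : ∀ j → Σ (Fin ℓ) λ c →
                   colourCount inc col j c ≡ 0 ×
                   (∀ c′ → c′ ≢ c → (ℓ ∸ 1) * colourCount inc col j c′ ≡ k)

γ : ∀ {v b ℓ} → (Fin b → Fin v → Bool) → (Fin v → Fin ℓ) → Fin ℓ → ℕ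
γ inc col c = count (λ j → does (colourCount inc col j c ℕ≟ 0))
  where open import Data.Nat using () renaming (_≟_ to _ℕ≟_)

-- In a symmetric design every point lies on k blocks, so k(k - 1) = λ(v - 1).
-- Fix a colour class of size n and let C_j be the number of its points on block j.
-- Counting incidences and pairs gives Σ C_j = kn and Σ C_j² = kn + λn(n - 1).
-- In a 0-ULSE colouring each C_j is either 0 (exactly on the γ blocks missing the
-- colour) or k/(ℓ - 1), so these sums are also (v - γ)k/(ℓ - 1) and (v - γ)k²/(ℓ - 1)².
-- Eliminating γ leaves k² + (ℓ - 1)λ = (ℓ - 1)k + (ℓ - 1)λn, so all colour classes
-- have the same size n = v/ℓ; then γ = v - (ℓ - 1)n = n, and substituting v = ℓn
-- into k(k - 1) = λ(v - 1) gives the formula for λ.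

module Submission where

open import Data.Nat using (ℕ; zero; suc; _+_; _*_; _∸_; _<_; _≤_; z≤n; s≤s; >-nonZero) renaming (_≟_ to _≟ℕ_)
open import Data.Nat.Properties hiding (_≟_)
open import Data.Nat.Divisibility using (_∣_; 0∣⇒≡0)
open import Data.Nat.Solver using (module +-*-Solver)
open import Data.Fin using (Fin; zero; suc; punchIn; fromℕ<; _≟_)
open import Data.Fin.Properties using (punchInᵢ≢i)
open import Data.Bool using (Bool; true; false; _∧_)
open import Data.Product using (_×_; _,_)
open import Data.Sum using (_⊎_; inj₁; inj₂)
open import Data.Vec.Functional using (removeAt)
open import Relation.Binary.PropositionalEquality
open import Relation.Nullary using (does; yes; no)
open import Relation.Nullary.Decidable using (dec-true)
open import Algebra.Properties.Semiring.Sum +-*-semiring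

open import Defs

open +-*-Solver

b2n-∧ : ∀ a b → b2n (a ∧ b) ≡ b2n a * b2n b
b2n-∧ true  true  = refl
b2n-∧ true  false = refl
b2n-∧ false b     = refl

b2n-idem : ∀ a → b2n a * b2n a ≡ b2n a
b2n-idem true  = refl
b2n-idem false = refl

count≡sum : ∀ {n} (P : Fin n → Bool) → count P ≡ ∑[ i < n ] b2n (P i)
count≡sum {zero}  P = refl
count≡sum {suc n} P = cong (b2n (P zero) +_) (count≡sum (λ i → P (suc i)))

count-false : ∀ n → count {n} (λ _ → false) ≡ 0
count-false zero    = refl
count-false (suc n) = count-false n

count-≟ : ∀ {n} (a : Fin n) → count (λ c → does (a ≟ c)) ≡ 1
count-≟ {suc n} zero    = cong suc (count-false n)
count-≟ {suc n} (suc a) = count-≟ a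

sum-const : ∀ n c → ∑[ i < n ] c ≡ n * c
sum-const zero    c = refl
sum-const (suc n) c = cong (c +_) (sum-const n c)

≤-sum : ∀ {n} (t : Fin n → ℕ) i → t i ≤ sum t
≤-sum {suc n} t i = ≤-trans (m≤m+n (t i) _) (≤-reflexive (sym (sum-remove {i = i} t)))

sum*sum : ∀ {n} (f g : Fin n → ℕ) → sum f * sum g ≡ ∑[ i < n ] ∑[ j < n ] (f i * g j)
sum*sum f g = trans (*-distribʳ-sum (sum g) f) (sum-cong-≗ (λ i → *-distribˡ-sum (f i) g))

sum-except : ∀ {n} (i : Fin n) (t w : Fin n → ℕ) c →
             (∀ j → j ≢ i → t j ≡ w j * c) → sum t + w i * c ≡ t i + c * sum w
sum-except {suc n} i t w c off = begin
  sum t + w i * c                          ≡⟨ cong (_+ w i * c) (sum-remove {i = i} t) ⟩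
  t i + sum (removeAt t i) + w i * c       ≡⟨ cong (λ s → t i + s + w i * c) rest ⟩
  t i + sum (removeAt w i) * c + w i * c   ≡⟨ solve 4 (λ a s b c → a :+ s :* c :+ b :* c := a :+ c :* (b :+ s))
                                                 refl (t i) (sum (removeAt w i)) (w i) c ⟩
  t i + c * (w i + sum (removeAt w i))     ≡⟨ cong (λ s → t i + c * s) (sum-remove {i = i} w) ⟨
  t i + c * sum w                          ∎
  where
  open ≡-Reasoning
  rest : sum (removeAt t i) ≡ sum (removeAt w i) * c
  rest = trans (sum-cong-≗ (λ j → off (punchIn i j) (punchInᵢ≢i i j)))
               (sym (*-distribʳ-sum c (removeAt w i)))

affine-injective : ∀ {k c M m n} → 2 ≤ k → m * k + c ≡ m + M → n * k + c ≡ n + M → m ≡ n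
affine-injective {suc (suc t)} {c} {M} {m} {n} (s≤s (s≤s _)) eqm eqn =
  *-cancelʳ-≡ m n (suc t) (+-cancelʳ-≡ c _ _ (trans (reduce m eqm) (sym (reduce n eqn))))
  where
  reduce : ∀ x → x * suc (suc t) + c ≡ x + M → x * suc t + c ≡ M
  reduce x eq = +-cancelˡ-≡ x _ _
    (trans (trans (sym (+-assoc x _ c)) (cong (_+ c) (sym (*-suc x (suc t))))) eq)

module BIBD {v k lam b} {inc : Fin b → Fin v → Bool} (D : IsBIBD v k lam b inc) where
  open IsBIBD D

  point : Fin v
  point = fromℕ< (≤-trans (s≤s z≤n) k<v)

  incidence : Fin b → Fin v → ℕ
  incidence j x = b2n (inc j x)

  replication : Fin v → ℕ
  replication x = ∑[ j < b ] incidence j x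

  pairCount : Fin v → Fin v → ℕ
  pairCount x y = ∑[ j < b ] (incidence j x * incidence j y)

  blockSize-sum : ∀ j → ∑[ x < v ] incidence j x ≡ k
  blockSize-sum j = trans (sym (count≡sum (inc j))) (blockSize j)

  pairCount-≢ : ∀ x y → x ≢ y → pairCount x y ≡ lam
  pairCount-≢ x y x≢y = begin
    pairCount x y                            ≡⟨ sum-cong-≗ (λ j → b2n-∧ (inc j x) (inc j y)) ⟨
    ∑[ j < b ] b2n (inc j x ∧ inc j y)       ≡⟨ count≡sum (λ j → inc j x ∧ inc j y) ⟨
    count (λ j → inc j x ∧ inc j y)          ≡⟨ pairs x y x≢y ⟩
    lam                                      ∎
    where open ≡-Reasoning

  pairCount-diag : ∀ x → pairCount x x ≡ replication x
  pairCount-diag x = sum-cong-≗ (λ j → b2n-idem (inc j x))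

  sum-pairCount : ∀ x → ∑[ y < v ] pairCount x y ≡ replication x * k
  sum-pairCount x = begin
    ∑[ y < v ] ∑[ j < b ] (incidence j x * incidence j y)   ≡⟨ ∑-comm (λ y j → incidence j x * incidence j y) ⟩
    ∑[ j < b ] ∑[ y < v ] (incidence j x * incidence j y)   ≡⟨ sum-cong-≗ (λ j → *-distribˡ-sum (incidence j x) (incidence j)) ⟨
    ∑[ j < b ] (incidence j x * ∑[ y < v ] incidence j y)   ≡⟨ sum-cong-≗ (λ j → cong (incidence j x *_) (blockSize-sum j)) ⟩
    ∑[ j < b ] (incidence j x * k)                          ≡⟨ *-distribʳ-sum k (λ j → incidence j x) ⟨
    replication x * k                                       ∎
    where open ≡-Reasoning

  replication-equation : ∀ x → replication x * k + lam ≡ replication x + lam * v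
  replication-equation x = begin
    replication x * k + lam                   ≡⟨ cong₂ _+_ (sum-pairCount x) (*-identityˡ lam) ⟨
    ∑[ y < v ] pairCount x y + 1 * lam        ≡⟨ sum-except x (pairCount x) (λ _ → 1) lam off-diagonal ⟩
    pairCount x x + lam * ∑[ y < v ] 1        ≡⟨ cong₂ (λ p s → p + lam * s) (pairCount-diag x)
                                                       (trans (sum-const v 1) (*-identityʳ v)) ⟩
    replication x + lam * v                   ∎
    where
    open ≡-Reasoning
    off-diagonal : ∀ y → y ≢ x → pairCount x y ≡ 1 * lam
    off-diagonal y y≢x = trans (pairCount-≢ x y (≢-sym y≢x)) (sym (*-identityˡ lam))

  replication-uniform : ∀ x y → replication x ≡ replication y
  replication-uniform x y = affine-injective two≤k (replication-equation x) (replication-equation y)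

  v*replication≡b*k : ∀ x → v * replication x ≡ b * k
  v*replication≡b*k x = begin
    v * replication x                           ≡⟨ sum-const v (replication x) ⟨
    ∑[ y < v ] replication x                    ≡⟨ sum-cong-≗ (λ y → replication-uniform x y) ⟩
    ∑[ y < v ] ∑[ j < b ] incidence j y         ≡⟨ ∑-comm (λ y j → incidence j y) ⟩
    ∑[ j < b ] ∑[ y < v ] incidence j y         ≡⟨ sum-cong-≗ blockSize-sum ⟩
    ∑[ j < b ] k                                ≡⟨ sum-const b k ⟩
    b * k                                       ∎
    where open ≡-Reasoning

  meet : (Fin v → Bool) → Fin b → ℕ
  meet S j = count (λ x → inc j x ∧ S x)

  meet≡sum : ∀ S j → meet S j ≡ ∑[ x < v ] (incidence j x * b2n (S x))
  meet≡sum S j = trans (count≡sum (λ x → inc j x ∧ S x)) (sum-cong-≗ (λ x → b2n-∧ (inc j x) (S x)))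

  module _ {r} (replication≡r : ∀ x → replication x ≡ r) (S : Fin v → Bool) where
    private
      h : Fin v → ℕ
      h x = b2n (S x)

      size≡sum : count S ≡ sum h
      size≡sum = count≡sum S

    sum-meet : ∑[ j < b ] meet S j ≡ r * count S
    sum-meet = begin
      ∑[ j < b ] meet S j                           ≡⟨ sum-cong-≗ (meet≡sum S) ⟩
      ∑[ j < b ] ∑[ x < v ] (incidence j x * h x)   ≡⟨ ∑-comm (λ j x → incidence j x * h x) ⟩
      ∑[ x < v ] ∑[ j < b ] (incidence j x * h x)   ≡⟨ sum-cong-≗ (λ x → *-distribʳ-sum (h x) (λ j → incidence j x)) ⟨
      ∑[ x < v ] (replication x * h x)              ≡⟨ sum-cong-≗ (λ x → cong (_* h x) (replication≡r x)) ⟩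
      ∑[ x < v ] (r * h x)                          ≡⟨ *-distribˡ-sum r h ⟨
      r * sum h                                     ≡⟨ cong (r *_) size≡sum ⟨
      r * count S                                   ∎
      where open ≡-Reasoning

    private
      weightedRow : Fin v → ℕ
      weightedRow x = ∑[ y < v ] (h y * pairCount x y)

      sum-meet²≡ : ∑[ j < b ] (meet S j * meet S j) ≡ ∑[ x < v ] (h x * weightedRow x)
      sum-meet²≡ = begin
        ∑[ j < b ] (meet S j * meet S j)
          ≡⟨ sum-cong-≗ (λ j → trans (cong₂ _*_ (meet≡sum S j) (meet≡sum S j)) (sum*sum (term j) (term j))) ⟩
        ∑[ j < b ] ∑[ x < v ] ∑[ y < v ] (term j x * term j y)
          ≡⟨ ∑-comm (λ j x → ∑[ y < v ] (term j x * term j y)) ⟩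
        ∑[ x < v ] ∑[ j < b ] ∑[ y < v ] (term j x * term j y)
          ≡⟨ sum-cong-≗ (λ x → ∑-comm (λ j y → term j x * term j y)) ⟩
        ∑[ x < v ] ∑[ y < v ] ∑[ j < b ] (term j x * term j y)
          ≡⟨ sum-cong-≗ (λ x → sum-cong-≗ (λ y → factor x y)) ⟩
        ∑[ x < v ] ∑[ y < v ] (h x * (h y * pairCount x y))
          ≡⟨ sum-cong-≗ (λ x → *-distribˡ-sum (h x) (λ y → h y * pairCount x y)) ⟨
        ∑[ x < v ] (h x * weightedRow x)
          ∎
        where
        open ≡-Reasoning
        term : Fin b → Fin v → ℕ
        term j x = incidence j x * h x
        factor : ∀ x y → ∑[ j < b ] (term j x * term j y) ≡ h x * (h y * pairCount x y)
        factor x y = begin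
          ∑[ j < b ] (term j x * term j y)
            ≡⟨ sum-cong-≗ (λ j → solve 4 (λ p a q c → (p :* a) :* (q :* c) := a :* c :* (p :* q))
                                         refl (incidence j x) (h x) (incidence j y) (h y)) ⟩
          ∑[ j < b ] (h x * h y * (incidence j x * incidence j y))
            ≡⟨ *-distribˡ-sum (h x * h y) (λ j → incidence j x * incidence j y) ⟨
          h x * h y * pairCount x y
            ≡⟨ *-assoc (h x) (h y) (pairCount x y) ⟩
          h x * (h y * pairCount x y)
            ∎

      weightedRow-equation : ∀ x → weightedRow x + h x * lam ≡ h x * r + lam * count S
      weightedRow-equation x = begin
        weightedRow x + h x * lam               ≡⟨ sum-except x (λ y → h y * pairCount x y) h lam off-diagonal ⟩
        h x * pairCount x x + lam * sum h       ≡⟨ cong₂ (λ p s → h x * p + lam * s)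
                                                         (trans (pairCount-diag x) (replication≡r x)) (sym size≡sum) ⟩
        h x * r + lam * count S                 ∎
        where
        open ≡-Reasoning
        off-diagonal : ∀ y → y ≢ x → h y * pairCount x y ≡ h y * lam
        off-diagonal y y≢x = cong (h y *_) (pairCount-≢ x y (≢-sym y≢x))

      weighted-equation : ∀ x → h x * weightedRow x + h x * lam ≡ h x * r + h x * (lam * count S)
      weighted-equation x with S x | weightedRow-equation x
      ... | false | _  = refl
      ... | true  | eq = begin
        1 * weightedRow x + 1 * lam            ≡⟨ cong (_+ 1 * lam) (*-identityˡ (weightedRow x)) ⟩
        weightedRow x + 1 * lam                ≡⟨ eq ⟩
        1 * r + lam * count S                  ≡⟨ cong (1 * r +_) (*-identityˡ (lam * count S)) ⟨
        1 * r + 1 * (lam * count S)            ∎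
        where open ≡-Reasoning

    sum-meet² : ∑[ j < b ] (meet S j * meet S j) + lam * count S ≡ r * count S + lam * (count S * count S)
    sum-meet² = begin
      ∑[ j < b ] (meet S j * meet S j) + lam * count S
        ≡⟨ cong₂ _+_ sum-meet²≡ (trans (cong (lam *_) size≡sum) (trans (*-comm lam (sum h)) (*-distribʳ-sum lam h))) ⟩
      ∑[ x < v ] (h x * weightedRow x) + ∑[ x < v ] (h x * lam)
        ≡⟨ ∑-distrib-+ (λ x → h x * weightedRow x) (λ x → h x * lam) ⟨
      ∑[ x < v ] (h x * weightedRow x + h x * lam)
        ≡⟨ sum-cong-≗ weighted-equation ⟩
      ∑[ x < v ] (h x * r + h x * (lam * count S))
        ≡⟨ ∑-distrib-+ (λ x → h x * r) (λ x → h x * (lam * count S)) ⟩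
      ∑[ x < v ] (h x * r) + ∑[ x < v ] (h x * (lam * count S))
        ≡⟨ cong₂ _+_ (*-distribʳ-sum r h) (*-distribʳ-sum (lam * count S) h) ⟨
      sum h * r + sum h * (lam * count S)
        ≡⟨ cong (λ s → s * r + s * (lam * count S)) size≡sum ⟨
      count S * r + count S * (lam * count S)
        ≡⟨ solve 3 (λ s r l → s :* r :+ s :* (l :* s) := r :* s :+ l :* (s :* s)) refl (count S) r lam ⟩
      r * count S + lam * (count S * count S)
        ∎
      where open ≡-Reasoning

zeroCount : ∀ {b} → (Fin b → ℕ) → ℕ
zeroCount C = count (λ j → does (C j ≟ℕ 0))

sum-twoValued : ∀ {b L k} (C : Fin b → ℕ) → (∀ j → C j ≡ 0 ⊎ L * C j ≡ k) →
                (F : ℕ → ℕ) → F 0 ≡ 0 →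
                ∑[ j < b ] F (L * C j) + F k * zeroCount C ≡ b * F k
sum-twoValued {b} {L} {k} C twoValued F F0≡0 = begin
  ∑[ j < b ] F (L * C j) + F k * zeroCount C
    ≡⟨ cong (∑[ j < b ] F (L * C j) +_) (trans (cong (F k *_) (count≡sum isZero)) (*-distribˡ-sum (F k) zeros)) ⟩
  ∑[ j < b ] F (L * C j) + ∑[ j < b ] (F k * zeros j)
    ≡⟨ ∑-distrib-+ (λ j → F (L * C j)) (λ j → F k * zeros j) ⟨
  ∑[ j < b ] (F (L * C j) + F k * zeros j)
    ≡⟨ sum-cong-≗ pointwise ⟩
  ∑[ j < b ] F k
    ≡⟨ sum-const b (F k) ⟩
  b * F k
    ∎
  where
  open ≡-Reasoning
  isZero : Fin b → Bool
  isZero j = does (C j ≟ℕ 0)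
  zeros : Fin b → ℕ
  zeros j = b2n (isZero j)
  pointwise : ∀ j → F (L * C j) + F k * b2n (does (C j ≟ℕ 0)) ≡ F k
  pointwise j with C j | twoValued j
  ... | zero  | _            = cong₂ _+_ (trans (cong F (*-zeroʳ L)) F0≡0) (*-identityʳ (F k))
  ... | suc _ | inj₂ LCj≡k  = trans (cong₂ _+_ (cong F LCj≡k) (*-zeroʳ (F k))) (+-identityʳ (F k))

lambda-identity : ∀ k lam L N →
                  k * k + lam ≡ k + lam * (suc L * N) →
                  k * k + L * lam ≡ L * k + L * (lam * N) →
                  lam * (L * L) + k * k ≡ k * (L * L)
lambda-identity k lam L N design classes = +-cancelʳ-≡ (L * (k + lam * (suc L * N))) _ _ (begin
  lam * (L * L) + k * k + L * (k + lam * (suc L * N))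
    ≡⟨ cong (λ t → lam * (L * L) + k * k + L * t) design ⟨
  lam * (L * L) + k * k + L * (k * k + lam)
    ≡⟨ solve 3 (λ k m l → m :* (l :* l) :+ k :* k :+ l :* (k :* k :+ m) := (con 1 :+ l) :* (k :* k :+ l :* m))
               refl k lam L ⟩
  suc L * (k * k + L * lam)
    ≡⟨ cong (suc L *_) classes ⟩
  suc L * (L * k + L * (lam * N))
    ≡⟨ solve 4 (λ k m l n → (con 1 :+ l) :* (l :* k :+ l :* (m :* n)) := k :* (l :* l) :+ l :* (k :+ m :* ((con 1 :+ l) :* n)))
               refl k lam L N ⟩
  k * (L * L) + L * (k + lam * (suc L * N))
    ∎)
  where open ≡-Reasoning

module Symmetric0ULSE {v k lam L} {inc : Fin v → Fin v → Bool} {col : Fin v → Fin (suc L)}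
                      (D : IsSymmetricBIBD v k lam inc) (U : Is0ULSE v k v (suc L) inc col) where
  open IsBIBD D
  open Is0ULSE U
  open BIBD D

  private
    0<k : 0 < k
    0<k = ≤-trans (s≤s z≤n) two≤k

    0<L : 0 < L
    0<L = n≢0⇒n>0 (λ L≡0 → >⇒≢ 0<k (0∣⇒≡0 (subst (_∣ k) L≡0 divides)))

  replication≡k : ∀ x → replication x ≡ k
  replication≡k x = *-cancelˡ-≡ (replication x) k v {{>-nonZero (≤-trans (s≤s z≤n) k<v)}} (v*replication≡b*k x)

  k*k+lam≡k+lam*v : k * k + lam ≡ k + lam * v
  k*k+lam≡k+lam*v = subst (λ r → r * k + lam ≡ r + lam * v) (replication≡k point) (replication-equation point)

  classSize : Fin (suc L) → ℕ
  classSize c = count (hasColour col c)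

  classSize-positive : ∀ c → 0 < classSize c
  classSize-positive c with surjective c
  ... | x , refl = ≤-trans (≤-reflexive (cong b2n (sym (dec-true (col x ≟ col x) refl))))
                           (subst (_ ≤_) (sym (count≡sum (hasColour col c))) (≤-sum _ x))

  colourCount-twoValued : ∀ c j → colourCount inc col j c ≡ 0 ⊎ L * colourCount inc col j c ≡ k
  colourCount-twoValued c j with absent j
  ... | d , d-absent , others with c ≟ d
  ...   | yes refl = inj₁ d-absent
  ...   | no c≢d   = inj₂ (others c c≢d)

  private
    module Colour (c : Fin (suc L)) where
      C : Fin v → ℕ
      C j = colourCount inc col j c

      n : ℕ
      n = classSize c

      sum-C : ∑[ j < v ] C j ≡ k * n
      sum-C = sum-meet replication≡k (hasColour col c)

      sum-C² : ∑[ j < v ] (C j * C j) + lam * n ≡ k * n + lam * (n * n)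
      sum-C² = sum-meet² replication≡k (hasColour col c)

      sum-twoValued-C : (F : ℕ → ℕ) → F 0 ≡ 0 → ∑[ j < v ] F (L * C j) + F k * γ inc col c ≡ v * F k
      sum-twoValued-C = sum-twoValued {L = L} C (colourCount-twoValued c)

  classSize+γ : ∀ c → L * classSize c + γ inc col c ≡ v
  classSize+γ c = *-cancelˡ-≡ _ _ k {{>-nonZero 0<k}} (begin
    k * (L * n + γ inc col c)            ≡⟨ solve 4 (λ k l n g → k :* (l :* n :+ g) := l :* (k :* n) :+ k :* g)
                                                   refl k L n (γ inc col c) ⟩
    L * (k * n) + k * γ inc col c        ≡⟨ cong (λ t → L * t + k * γ inc col c) sum-C ⟨
    L * sum C + k * γ inc col c          ≡⟨ cong (_+ k * γ inc col c) (*-distribˡ-sum L C) ⟩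
    ∑[ j < v ] (L * C j) + k * γ inc col c ≡⟨ sum-twoValued-C (λ x → x) refl ⟩
    v * k                                ≡⟨ *-comm v k ⟩
    k * v                                ∎)
    where
    open ≡-Reasoning
    open Colour c

  private
    sum-C²-scaled : ∀ c → let open Colour c in L * L * ∑[ j < v ] (C j * C j) ≡ k * k * (L * n)
    sum-C²-scaled c = +-cancelʳ-≡ (k * k * γ inc col c) _ _ (begin
      L * L * ∑[ j < v ] (C j * C j) + k * k * γ inc col c
        ≡⟨ cong (_+ k * k * γ inc col c) (trans (*-distribˡ-sum (L * L) (λ j → C j * C j)) (sum-cong-≗ square)) ⟩
      ∑[ j < v ] (L * C j * (L * C j)) + k * k * γ inc col c
        ≡⟨ sum-twoValued-C (λ x → x * x) refl ⟩
      v * (k * k)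
        ≡⟨ cong (_* (k * k)) (classSize+γ c) ⟨
      (L * n + γ inc col c) * (k * k)
        ≡⟨ solve 4 (λ l n g k → (l :* n :+ g) :* (k :* k) := k :* k :* (l :* n) :+ k :* k :* g)
                   refl L n (γ inc col c) k ⟩
      k * k * (L * n) + k * k * γ inc col c
        ∎)
      where
      open ≡-Reasoning
      open Colour c
      square : ∀ j → L * L * (C j * C j) ≡ L * C j * (L * C j)
      square j = solve 2 (λ l x → l :* l :* (x :* x) := l :* x :* (l :* x)) refl L (C j)

  classSize-equation : ∀ c → k * k + L * lam ≡ L * k + L * (lam * classSize c)
  classSize-equation c = *-cancelˡ-≡ _ _ (L * n) {{>-nonZero (*-mono-< 0<L (classSize-positive c))}} (begin
    L * n * (k * k + L * lam)
      ≡⟨ solve 4 (λ l n k m → l :* n :* (k :* k :+ l :* m) := k :* k :* (l :* n) :+ l :* l :* (n :* m))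
                 refl L n k lam ⟩
    k * k * (L * n) + L * L * (n * lam)
      ≡⟨ cong (_+ L * L * (n * lam)) (sum-C²-scaled c) ⟨
    L * L * ∑[ j < v ] (C j * C j) + L * L * (n * lam)
      ≡⟨ *-distribˡ-+ (L * L) _ (n * lam) ⟨
    L * L * (∑[ j < v ] (C j * C j) + n * lam)
      ≡⟨ cong (λ t → L * L * (∑[ j < v ] (C j * C j) + t)) (*-comm n lam) ⟩
    L * L * (∑[ j < v ] (C j * C j) + lam * n)
      ≡⟨ cong (L * L *_) sum-C² ⟩
    L * L * (k * n + lam * (n * n))
      ≡⟨ solve 4 (λ l n k m → l :* l :* (k :* n :+ m :* (n :* n)) := l :* n :* (l :* k :+ l :* (m :* n)))
                 refl L n k lam ⟩
    L * n * (L * k + L * (lam * n))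
      ∎)
    where
    open ≡-Reasoning
    open Colour c

  classSize-uniform : ∀ c d → classSize c ≡ classSize d
  classSize-uniform c d =
    *-cancelˡ-≡ _ _ lam {{>-nonZero lam-pos}} (*-cancelˡ-≡ _ _ L {{>-nonZero 0<L}}
      (+-cancelˡ-≡ (L * k) _ _ (trans (sym (classSize-equation c)) (classSize-equation d))))

  sum-classSize : ∑[ c < suc L ] classSize c ≡ v
  sum-classSize = begin
    ∑[ c < suc L ] classSize c                            ≡⟨ sum-cong-≗ (λ c → count≡sum (hasColour col c)) ⟩
    ∑[ c < suc L ] ∑[ x < v ] b2n (does (col x ≟ c))      ≡⟨ ∑-comm (λ c x → b2n (does (col x ≟ c))) ⟩
    ∑[ x < v ] ∑[ c < suc L ] b2n (does (col x ≟ c))      ≡⟨ sum-cong-≗ (λ x → trans (sym (count≡sum (λ c → does (col x ≟ c)))) (count-≟ (col x))) ⟩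
    ∑[ x < v ] 1                                          ≡⟨ trans (sum-const v 1) (*-identityʳ v) ⟩
    v                                                     ∎
    where open ≡-Reasoning

  N : ℕ
  N = classSize (col point)

  v≡ℓ*N : v ≡ suc L * N
  v≡ℓ*N = begin
    v                              ≡⟨ sum-classSize ⟨
    ∑[ c < suc L ] classSize c     ≡⟨ sum-cong-≗ (λ c → classSize-uniform c (col point)) ⟩
    ∑[ c < suc L ] N               ≡⟨ sum-const (suc L) N ⟩
    suc L * N                      ∎
    where open ≡-Reasoning

  γ*ℓ≡v : ∀ c → γ inc col c * suc L ≡ v
  γ*ℓ≡v c = trans (cong (_* suc L) γ≡N) (trans (*-comm N (suc L)) (sym v≡ℓ*N))
    where
    γ≡N : γ inc col c ≡ N
    γ≡N = +-cancelˡ-≡ (L * N) _ _ (begin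
      L * N + γ inc col c             ≡⟨ cong (λ t → L * t + γ inc col c) (classSize-uniform (col point) c) ⟩
      L * classSize c + γ inc col c   ≡⟨ classSize+γ c ⟩
      v                               ≡⟨ v≡ℓ*N ⟩
      N + L * N                       ≡⟨ +-comm N (L * N) ⟩
      L * N + N                       ∎)
      where open ≡-Reasoning

  lambda-formula : lam * (L * L) + k * k ≡ k * (L * L)
  lambda-formula = lambda-identity k lam L N (subst (λ t → k * k + lam ≡ k + lam * t) v≡ℓ*N k*k+lam≡k+lam*v)
                                   (classSize-equation (col point))

theorem3p11 : (v k lam ℓ : ℕ) (inc : Fin v → Fin v → Bool) (col : Fin v → Fin ℓ) →
    IsSymmetricBIBD v k lam inc → Is0ULSE v k v ℓ inc col →
    (lam * ((ℓ ∸ 1) * (ℓ ∸ 1)) + k * k ≡ k * ((ℓ ∸ 1) * (ℓ ∸ 1)))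
    × (∀ (c : Fin ℓ) → γ inc col c * ℓ ≡ v)
theorem3p11 v k lam zero    inc col D U with () ← col (BIBD.point D)
theorem3p11 v k lam (suc L) inc col D U = lambda-formula , γ*ℓ≡v
  where open Symmetric0ULSE D U
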